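{- For every reduced $n$-expression $u$ there exist an $(n-1)$-expression $v$ (i.e. a word over $\{\sigma_1,\dots,\sigma_{n-2}\}$) and an integer $k\le n$ such that $v\,\sigma_{n,k}$ is a reduced $n$-expression equivalent to $u$ and $\operatorname{dist}(u, v\,\sigma_{n,k}) \le \operatorname{area}(u)$.
   Context: For $1\le i\le n-1$, $\sigma_i$ is the transposition exchanging $i$ and $i+1$. An $n$-expression is a word over $\{\sigma_1,\dots,\sigma_{n-1}\}$, representing the product of its letters read left to right; two are equivalent if they represent the same permutation; reduced means no shorter expression of the same permutation exists. Braid relations: (I) $\sigma_i\sigma_j\sigma_i=\sigma_j\sigma_i\sigma_j$ for $|i-j|=1$; (II) $\sigma_i\sigma_j=\sigma_j\sigma_i$ for $|i-j|\ge2$. For equivalent reduced $u,v$, $\operatorname{dist}(u,v)$ is the minimal number of braid-relation applications transforming $u$ into $v$. For $j>i$, $\sigma_{j,i}=\sigma_{j-1}\sigma_{j-2}\cdots\sigma_i$, and $\sigma_{i,i}$ is empty. Braid diagram and area: for $u=\sigma_{i_1}\cdots\sigma_{i_\ell}$, consider $n$ positions $1,\dots,n$ and $\ell$ rows; row $t$ realizes the crossing of the strands occupying positions $i_t$ and $i_t+1$, the other strands staying in place. The diagram is drawn in an $(n-1)\times\ell$ grid of unit squares, the square in column $c$ ($1\le c\le n-1$) of row $t$ lying between positions $c$ and $c+1$. The $n$th strand is the strand starting at position $n$. If in row $t$ the $n$th strand is at position $p$ before and $p'$ after the crossing, the squares of row $t$ counted are those in columns $c\ge\max(p,p')$. $\operatorname{area}(u)$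 is the total number of counted squares over all rows (i.e. the number of unit squares lying entirely to the right of the $n$th strand). -}

module Defs where

open import Data.Nat using (ℕ; zero; suc; _+_; _∸_; _≤_; _<_; _⊔_; _≟_; _≤?_)
open import Data.List using (List; []; _∷_; _++_; length)
open import Data.List.Relation.Unary.All using (All)
open import Data.Product using (_×_; Σ)
open import Data.Sum using (_⊎_)
open import Relation.Nullary using (yes; no)
open import Relation.Binary.PropositionalEquality using (_≡_)

-- A word: list of letter indices; letter i stands for σ_i.
Word : Set
Word = List ℕ

IsExpr : ℕ → Word → Set
IsExpr n w = All (λ i → 1 ≤ i × suc i ≤ n) w

-- the transposition σ_i acting on positions (ℕ), exchanging i and i+1
swap : ℕ → ℕ → ℕ
swap i p with p ≟ i
... | yes _ = suc i
... | no _ with p ≟ suc i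
...   | yes _ = i
...   | no _ = p

-- action of the product of the letters (read left to right) on positions
act : Word → ℕ → ℕ
act [] p = p
act (i ∷ w) p = act w (swap i p)

Equiv : Word → Word → Set
Equiv u v = ∀ p → act u p ≡ act v p

Reduced : ℕ → Word → Set
Reduced n u = IsExpr n u × (∀ w → IsExpr n w → Equiv u w → length u ≤ length w)

data BraidStep : Word → Word → Set where
  braid3 : ∀ a b i j → (suc i ≡ j) ⊎ (suc j ≡ i) →
           BraidStep (a ++ i ∷ j ∷ i ∷ b) (a ++ j ∷ i ∷ j ∷ b)
  braid2 : ∀ a b i j → (suc (suc i) ≤ j) ⊎ (suc (suc j) ≤ i) →
           BraidStep (a ++ i ∷ j ∷ b) (a ++ j ∷ i ∷ b)

data Reaches : ℕ → Word → Word → Set where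
  here : ∀ {u} → Reaches 0 u u
  step : ∀ {k u w v} → BraidStep u w → Reaches k w v → Reaches (suc k) u v

-- dist(u,v) ≤ m  (dist is the minimal number of braid applications)
DistLe : Word → Word → ℕ → Set
DistLe u v m = Σ ℕ (λ k → k ≤ m × Reaches k u v)

-- σ_{j,i} = σ_{j-1} σ_{j-2} ⋯ σ_i  (empty if i ≥ j)
sigmaDown : ℕ → ℕ → Word
sigmaDown zero i = []
sigmaDown (suc j) i with i ≤? j
... | yes _ = j ∷ sigmaDown j i
... | no _ = []

-- area: p = current position of the n-th strand (initially n);
-- a row moving it from p to p' contributes the columns c with max(p,p') ≤ c ≤ n-1
areaFrom : ℕ → ℕ → Word → ℕ
areaFrom n p [] = 0
areaFrom n p (i ∷ w) = (n ∸ (p ⊔ swap i p)) + areaFrom n (swap i p) w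

area : ℕ → Word → ℕ
area n u = areaFrom n n u

module Submission where

-- Let N = n' + 1.  By induction on u, adding letters on the
-- right, every reduced N-expression u admits a factorisation: a word v
-- avoiding σ_{N-1} and a cut 1 ≤ k ≤ N with dist(u, v σ_{N,k}) ≤ area(u).
-- Since v fixes position N and σ_{N,k} sends N to k, the N-th strand of u
-- ends at position k.  Appending a letter σ_i to u = v σ_{N,k}:
--   * i = k-1 : v σ_{N,k} σ_{k-1} is literally v σ_{N,k-1};
--   * i = k   : σ_{N,k} ends in σ_k, so u σ_k would not be reduced;
--   * i ≤ k-2 : σ_i commutes past all of σ_{N,k};
--   * i ≥ k+1 : σ_{N,k} σ_i = H σ_i σ_{i-1} L σ_i → H σ_i σ_{i-1} σ_i L
--               → H σ_{i-1} σ_i σ_{i-1} L → σ_{i-1} σ_{N,k}, by commutations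
--               and a single braid (I).
-- In the last two cases at most length(σ_{N,k}) ≤ N - k braid moves are
-- used, and the strand, resting at k, adds exactly N - k to the area.

open import Defs
open import Data.Nat using (ℕ; zero; suc; _+_; _∸_; _≤_; _<_; _⊔_; _≟_; _≤?_; z≤n; s≤s)
open import Data.Nat.Properties
open import Data.List using ([]; _∷_; _++_; length)
open import Data.List.Properties using (length-++; ++-assoc; ++-identityʳ)
open import Data.List.Relation.Unary.All using (All; []; _∷_) renaming (map to all-map)
open import Data.List.Relation.Unary.All.Properties using (++⁺; ++⁻ˡ; ++⁻ʳ)
open import Data.List.Reverse using (Reverse; []; _∶_∶ʳ_; reverseView)
open import Data.Product using (Σ; _×_; _,_)
open import Data.Sum using (_⊎_; inj₁; inj₂)
open import Data.Empty using (⊥-elim)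
open import Relation.Nullary using (yes; no; ¬_; Dec)
open import Relation.Binary.PropositionalEquality
open import Relation.Binary using (tri<; tri≈; tri>)

swap-left : ∀ i → swap i i ≡ suc i
swap-left i with i ≟ i
... | yes _ = refl
... | no i≢i = ⊥-elim (i≢i refl)

swap-right : ∀ i → swap i (suc i) ≡ i
swap-right i with suc i ≟ i
... | yes e = ⊥-elim (1+n≢n e)
... | no _ with suc i ≟ suc i
...   | yes _ = refl
...   | no ne = ⊥-elim (ne refl)

swap-other : ∀ i p → p ≢ i → p ≢ suc i → swap i p ≡ p
swap-other i p p≢i p≢si with p ≟ i
... | yes e = ⊥-elim (p≢i e)
... | no _ with p ≟ suc i
...   | yes e = ⊥-elim (p≢si e)
...   | no _ = refl

swap-below : ∀ i p → suc p ≤ i → swap i p ≡ p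
swap-below i p p<i = swap-other i p (<⇒≢ p<i) (<⇒≢ (m<n⇒m<1+n p<i))

swap-above : ∀ i p → suc (suc i) ≤ p → swap i p ≡ p
swap-above i p ssi≤p = swap-other i p (>⇒≢ (<-trans (n<1+n i) ssi≤p)) (>⇒≢ ssi≤p)

swap-involutive : ∀ i p → swap i (swap i p) ≡ p
swap-involutive i p = by-cases (p ≟ i) (p ≟ suc i)
  where
  by-cases : Dec (p ≡ i) → Dec (p ≡ suc i) → swap i (swap i p) ≡ p
  by-cases (yes refl) _ = trans (cong (swap i) (swap-left i)) (swap-right i)
  by-cases (no _) (yes refl) = trans (cong (swap i) (swap-right i)) (swap-left i)
  by-cases (no p≢i) (no p≢si) =
    trans (cong (swap i) (swap-other i p p≢i p≢si)) (swap-other i p p≢i p≢si)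

swap-braid : ∀ i q → swap i (swap (suc i) (swap i q)) ≡ swap (suc i) (swap i (swap (suc i) q))
swap-braid i q = by-cases (q ≟ i) (q ≟ suc i) (q ≟ suc (suc i))
  where
  by-cases : Dec (q ≡ i) → Dec (q ≡ suc i) → Dec (q ≡ suc (suc i)) →
             swap i (swap (suc i) (swap i q)) ≡ swap (suc i) (swap i (swap (suc i) q))
  by-cases (yes refl) _ _
    rewrite swap-left i | swap-left (suc i) | swap-above i (suc (suc i)) ≤-refl
          | swap-below (suc i) i ≤-refl | swap-left i | swap-left (suc i) = refl
  by-cases (no _) (yes refl) _
    rewrite swap-right i | swap-below (suc i) i ≤-refl | swap-left i
          | swap-left (suc i) | swap-above i (suc (suc i)) ≤-refl | swap-right (suc i) = refl
  by-cases (no _) (no _) (yes refl)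
    rewrite swap-above i (suc (suc i)) ≤-refl | swap-right (suc i) | swap-right i
          | swap-below (suc i) i ≤-refl = refl
  by-cases (no q≢i) (no q≢si) (no q≢ssi)
    rewrite swap-other i q q≢i q≢si | swap-other (suc i) q q≢si q≢ssi
          | swap-other i q q≢i q≢si | swap-other (suc i) q q≢si q≢ssi = refl

swap-commute : ∀ i j → suc (suc i) ≤ j → ∀ q → swap j (swap i q) ≡ swap i (swap j q)
swap-commute i j ssi≤j q = by-cases (q ≟ i) (q ≟ suc i) (q ≟ j) (q ≟ suc j)
  where
  i<j : i < j
  i<j = <-trans (n<1+n i) ssi≤j
  ssi≤sj : suc (suc i) ≤ suc j
  ssi≤sj = m≤n⇒m≤1+n ssi≤j
  by-cases : Dec (q ≡ i) → Dec (q ≡ suc i) → Dec (q ≡ j) → Dec (q ≡ suc j) →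
             swap j (swap i q) ≡ swap i (swap j q)
  by-cases (yes refl) _ _ _
    rewrite swap-left i | swap-below j (suc i) ssi≤j | swap-below j i i<j | swap-left i = refl
  by-cases (no _) (yes refl) _ _
    rewrite swap-right i | swap-below j i i<j | swap-below j (suc i) ssi≤j | swap-right i = refl
  by-cases (no _) (no _) (yes refl) _
    rewrite swap-above i j ssi≤j | swap-left j | swap-above i (suc j) ssi≤sj = refl
  by-cases (no _) (no _) (no _) (yes refl)
    rewrite swap-above i (suc j) ssi≤sj | swap-right j | swap-above i j ssi≤j = refl
  by-cases (no q≢i) (no q≢si) (no q≢j) (no q≢sj)
    rewrite swap-other i q q≢i q≢si | swap-other j q q≢j q≢sj | swap-other i q q≢i q≢si = refl

act-++ : ∀ a w p → act (a ++ w) p ≡ act w (act a p)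
act-++ [] w p = refl
act-++ (i ∷ a) w p = act-++ a w (swap i p)

braid-step-equiv : ∀ {u w} → BraidStep u w → Equiv u w
braid-step-equiv (braid3 a b i j rel) p
  rewrite act-++ a (i ∷ j ∷ i ∷ b) p | act-++ a (j ∷ i ∷ j ∷ b) p = cong (act b) (local rel)
  where
  local : (suc i ≡ j) ⊎ (suc j ≡ i) →
          swap i (swap j (swap i (act a p))) ≡ swap j (swap i (swap j (act a p)))
  local (inj₁ refl) = swap-braid i (act a p)
  local (inj₂ refl) = sym (swap-braid j (act a p))
braid-step-equiv (braid2 a b i j far) p
  rewrite act-++ a (i ∷ j ∷ b) p | act-++ a (j ∷ i ∷ b) p = cong (act b) (local far)
  where
  local : (suc (suc i) ≤ j) ⊎ (suc (suc j) ≤ i) →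
          swap j (swap i (act a p)) ≡ swap i (swap j (act a p))
  local (inj₁ h) = swap-commute i j h (act a p)
  local (inj₂ h) = sym (swap-commute j i h (act a p))

reaches-equiv : ∀ {d u v} → Reaches d u v → Equiv u v
reaches-equiv here p = refl
reaches-equiv (step s r) p = trans (braid-step-equiv s p) (reaches-equiv r p)

braid-step-length : ∀ {u w} → BraidStep u w → length u ≡ length w
braid-step-length (braid3 a b i j _) = trans (length-++ a) (sym (length-++ a))
braid-step-length (braid2 a b i j _) = trans (length-++ a) (sym (length-++ a))

reaches-length : ∀ {d u v} → Reaches d u v → length u ≡ length v
reaches-length here = refl
reaches-length (step s r) = trans (braid-step-length s) (reaches-length r)

braid-step-prefix : ∀ c {u w} → BraidStep u w → BraidStep (c ++ u) (c ++ w)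
braid-step-prefix c (braid3 a b i j rel) =
  subst₂ BraidStep (++-assoc c a _) (++-assoc c a _) (braid3 (c ++ a) b i j rel)
braid-step-prefix c (braid2 a b i j far) =
  subst₂ BraidStep (++-assoc c a _) (++-assoc c a _) (braid2 (c ++ a) b i j far)

braid-step-suffix : ∀ c {u w} → BraidStep u w → BraidStep (u ++ c) (w ++ c)
braid-step-suffix c (braid3 a b i j rel) =
  subst₂ BraidStep (sym (++-assoc a (i ∷ j ∷ i ∷ b) c)) (sym (++-assoc a (j ∷ i ∷ j ∷ b) c))
    (braid3 a (b ++ c) i j rel)
braid-step-suffix c (braid2 a b i j far) =
  subst₂ BraidStep (sym (++-assoc a (i ∷ j ∷ b) c)) (sym (++-assoc a (j ∷ i ∷ b) c))
    (braid2 a (b ++ c) i j far)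

reaches-prefix : ∀ c {d u w} → Reaches d u w → Reaches d (c ++ u) (c ++ w)
reaches-prefix c here = here
reaches-prefix c (step s r) = step (braid-step-prefix c s) (reaches-prefix c r)

reaches-suffix : ∀ c {d u w} → Reaches d u w → Reaches d (u ++ c) (w ++ c)
reaches-suffix c here = here
reaches-suffix c (step s r) = step (braid-step-suffix c s) (reaches-suffix c r)

reaches-trans : ∀ {d e u w v} → Reaches d u w → Reaches e w v → Reaches (d + e) u v
reaches-trans here r = r
reaches-trans (step s r) r' = step s (reaches-trans r r')

dist-refl : ∀ {u} → DistLe u u 0
dist-refl = 0 , z≤n , here

dist-step : ∀ {u v} → BraidStep u v → DistLe u v 1
dist-step s = 1 , ≤-refl , step s here

dist-prefix : ∀ c {u w m} → DistLe u w m → DistLe (c ++ u) (c ++ w) m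
dist-prefix c (d , d≤m , r) = d , d≤m , reaches-prefix c r

dist-suffix : ∀ c {u w m} → DistLe u w m → DistLe (u ++ c) (w ++ c) m
dist-suffix c (d , d≤m , r) = d , d≤m , reaches-suffix c r

dist-trans : ∀ {u w v m m'} → DistLe u w m → DistLe w v m' → DistLe u v (m + m')
dist-trans (d , d≤m , r) (d' , d'≤m' , r') = d + d' , +-mono-≤ d≤m d'≤m' , reaches-trans r r'

dist-weaken : ∀ {u v m m'} → m ≤ m' → DistLe u v m → DistLe u v m'
dist-weaken m≤m' (d , d≤m , r) = d , ≤-trans d≤m m≤m' , r

Far : ℕ → ℕ → Set
Far x y = (suc (suc x) ≤ y) ⊎ (suc (suc y) ≤ x)

commute-left : ∀ y b s → All (λ x → Far x y) s → DistLe (s ++ y ∷ b) (y ∷ s ++ b) (length s)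
commute-left y b [] [] = dist-refl
commute-left y b (x ∷ s) (far ∷ fars) =
  dist-weaken (≤-reflexive (+-comm (length s) 1))
    (dist-trans (dist-prefix (x ∷ []) (commute-left y b s fars))
                (dist-step (braid2 [] (s ++ b) x y far)))

-- The letter i+1 travels leftwards through H σ_{i+1} σ_i L, becoming σ_i:
-- past L by commutations, one braid (I), then past H by commutations.
braid-through : ∀ i H L → All (λ x → Far x i) H → All (λ x → Far x (suc i)) L →
                DistLe ((H ++ suc i ∷ i ∷ L) ++ suc i ∷ []) (i ∷ H ++ suc i ∷ i ∷ L)
                       (length (H ++ suc i ∷ i ∷ L))
braid-through i H L H-far L-far =
  dist-weaken cost (subst₂ (λ a b → DistLe a b (length L + 1 + length H)) reassoc drop-nil moves)
  where
  moves : DistLe (H ++ suc i ∷ i ∷ L ++ suc i ∷ []) (i ∷ H ++ suc i ∷ i ∷ L ++ [])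
                 (length L + 1 + length H)
  moves = dist-trans
            (dist-trans (dist-prefix H (dist-prefix (suc i ∷ i ∷ []) (commute-left (suc i) [] L L-far)))
                        (dist-step (braid3 H (L ++ []) (suc i) i (inj₂ refl))))
            (commute-left i (suc i ∷ i ∷ L ++ []) H H-far)
  reassoc : H ++ suc i ∷ i ∷ L ++ suc i ∷ [] ≡ (H ++ suc i ∷ i ∷ L) ++ suc i ∷ []
  reassoc = sym (++-assoc H (suc i ∷ i ∷ L) (suc i ∷ []))
  drop-nil : i ∷ H ++ suc i ∷ i ∷ L ++ [] ≡ i ∷ H ++ suc i ∷ i ∷ L
  drop-nil = cong (λ w → i ∷ H ++ suc i ∷ i ∷ w) (++-identityʳ L)
  cost : length L + 1 + length H ≤ length (H ++ suc i ∷ i ∷ L)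
  cost = begin
      length L + 1 + length H   ≡⟨ +-comm (length L + 1) (length H) ⟩
      length H + (length L + 1) ≤⟨ +-monoʳ-≤ (length H) (+-monoʳ-≤ (length L) (n≤1+n 1)) ⟩
      length H + (length L + 2) ≡⟨ cong (length H +_) (+-comm (length L) 2) ⟩
      length H + (2 + length L) ≡⟨ sym (length-++ H) ⟩
      length (H ++ suc i ∷ i ∷ L) ∎
    where open ≤-Reasoning

sigmaDown-empty : ∀ j → sigmaDown j j ≡ []
sigmaDown-empty zero = refl
sigmaDown-empty (suc j) with suc j ≤? j
... | yes sj≤j = ⊥-elim (<-irrefl refl sj≤j)
... | no _ = refl

sigmaDown-suc : ∀ j k → k ≤ j → sigmaDown (suc j) k ≡ j ∷ sigmaDown j k
sigmaDown-suc j k k≤j with k ≤? j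
... | yes _ = refl
... | no k≰j = ⊥-elim (k≰j k≤j)

sigmaDown-split : ∀ n m k → k ≤ m → m ≤ n → sigmaDown n k ≡ sigmaDown n m ++ sigmaDown m k
sigmaDown-split zero .zero k _ z≤n = refl
sigmaDown-split (suc j) m k k≤m m≤n with m≤n⇒m<n∨m≡n m≤n
... | inj₂ refl = cong (_++ sigmaDown (suc j) k) (sym (sigmaDown-empty (suc j)))
... | inj₁ (s≤s m≤j) =
  trans (sigmaDown-suc j k (≤-trans k≤m m≤j))
    (trans (cong (j ∷_) (sigmaDown-split j m k k≤m m≤j))
           (cong (_++ sigmaDown m k) (sym (sigmaDown-suc j m m≤j))))

sigmaDown-last : ∀ n k → suc k ≤ n → sigmaDown n k ≡ sigmaDown n (suc k) ++ k ∷ []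
sigmaDown-last n k sk≤n =
  trans (sigmaDown-split n (suc k) k (n≤1+n k) sk≤n)
        (cong (sigmaDown n (suc k) ++_) (trans (sigmaDown-suc k k ≤-refl)
                                                (cong (k ∷_) (sigmaDown-empty k))))

sigmaDown-around : ∀ n k i → k ≤ i → suc (suc i) ≤ n →
                   sigmaDown n k ≡ sigmaDown n (suc (suc i)) ++ suc i ∷ i ∷ sigmaDown i k
sigmaDown-around n k i k≤i ssi≤n =
  trans (sigmaDown-split n (suc (suc i)) k (≤-trans k≤i (m≤n⇒m≤1+n (n≤1+n i))) ssi≤n)
    (cong (sigmaDown n (suc (suc i)) ++_)
      (trans (sigmaDown-suc (suc i) k (m≤n⇒m≤1+n k≤i)) (cong (suc i ∷_) (sigmaDown-suc i k k≤i))))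

sigmaDown-length : ∀ n k → length (sigmaDown n k) ≤ n ∸ k
sigmaDown-length zero k = z≤n
sigmaDown-length (suc j) k with k ≤? j
... | yes k≤j = ≤-trans (s≤s (sigmaDown-length j k)) (≤-reflexive (sym (+-∸-assoc 1 k≤j)))
... | no _ = z≤n

sigmaDown-letters : ∀ n k → All (λ x → k ≤ x × x < n) (sigmaDown n k)
sigmaDown-letters zero k = []
sigmaDown-letters (suc j) k with k ≤? j
... | yes k≤j = (k≤j , n<1+n j) ∷ all-map (λ { (k≤x , x<j) → k≤x , m<n⇒m<1+n x<j })
                                           (sigmaDown-letters j k)
... | no _ = []

sigmaDown-expr : ∀ n k → 1 ≤ k → IsExpr n (sigmaDown n k)
sigmaDown-expr n k 1≤k = all-map (λ { (k≤x , x<n) → ≤-trans 1≤k k≤x , x<n }) (sigmaDown-letters n k)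

act-sigmaDown : ∀ n k → k ≤ n → act (sigmaDown n k) n ≡ k
act-sigmaDown zero .zero z≤n = refl
act-sigmaDown (suc j) k k≤n with m≤n⇒m<n∨m≡n k≤n
... | inj₂ refl = cong (λ w → act w (suc j)) (sigmaDown-empty (suc j))
... | inj₁ (s≤s k≤j)
  rewrite sigmaDown-suc j k k≤j | swap-right j = act-sigmaDown j k k≤j

act-fixes-above : ∀ n v → IsExpr n v → act v (suc n) ≡ suc n
act-fixes-above n [] [] = refl
act-fixes-above n (i ∷ v) ((_ , si≤n) ∷ valid)
  rewrite swap-above i (suc n) (s≤s si≤n) = act-fixes-above n v valid

-- Area is additive: the strand enters the second piece where the first left it.
areaFrom-++ : ∀ n p a b → areaFrom n p (a ++ b) ≡ areaFrom n p a + areaFrom n (act a p) b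
areaFrom-++ n p [] b = refl
areaFrom-++ n p (i ∷ a) b =
  trans (cong ((n ∸ (p ⊔ swap i p)) +_) (areaFrom-++ n (swap i p) a b))
        (sym (+-assoc (n ∸ (p ⊔ swap i p)) _ _))

area-snoc-≥ : ∀ n u i → area n u ≤ area n (u ++ i ∷ [])
area-snoc-≥ n u i = ≤-trans (m≤m+n (area n u) _) (≤-reflexive (sym (areaFrom-++ n n u (i ∷ []))))

area-snoc-fixed : ∀ n u i k → act u n ≡ k → swap i k ≡ k →
                  area n (u ++ i ∷ []) ≡ area n u + (n ∸ k)
area-snoc-fixed n u i k strand fixed = begin
    area n (u ++ i ∷ [])
  ≡⟨ areaFrom-++ n n u (i ∷ []) ⟩
    area n u + (n ∸ (act u n ⊔ swap i (act u n)) + 0)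
  ≡⟨ cong (λ q → area n u + (n ∸ (q ⊔ swap i q) + 0)) strand ⟩
    area n u + (n ∸ (k ⊔ swap i k) + 0)
  ≡⟨ cong (λ q → area n u + (n ∸ (k ⊔ q) + 0)) fixed ⟩
    area n u + (n ∸ (k ⊔ k) + 0)
  ≡⟨ cong (λ q → area n u + (q + 0)) (cong (n ∸_) (⊔-idem k)) ⟩
    area n u + (n ∸ k + 0)
  ≡⟨ cong (area n u +_) (+-identityʳ (n ∸ k)) ⟩
    area n u + (n ∸ k) ∎
  where open ≡-Reasoning

reduced-prefix : ∀ n u i → Reduced n (u ++ i ∷ []) → Reduced n u
reduced-prefix n u i (valid , minimal) = ++⁻ˡ u valid , λ w w-valid u≈w →
  let longer = minimal (w ++ i ∷ []) (++⁺ w-valid (++⁻ʳ u valid))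
                 (λ p → trans (act-++ u (i ∷ []) p)
                          (trans (cong (swap i) (u≈w p)) (sym (act-++ w (i ∷ []) p))))
  in +-cancelʳ-≤ 1 (length u) (length w) (subst₂ _≤_ (length-++ u) (length-++ w) longer)

reduced-reaches : ∀ {n d u w} → Reduced n u → IsExpr n w → Reaches d u w → Reduced n w
reduced-reaches (_ , minimal) w-valid r =
  w-valid , λ x x-valid w≈x →
    subst (_≤ length x) (reaches-length r) (minimal x x-valid (λ p → trans (reaches-equiv r p) (w≈x p)))

square-not-reduced : ∀ n w i → ¬ Reduced n ((w ++ i ∷ []) ++ i ∷ [])
square-not-reduced n w i (valid , minimal) = <-irrefl refl (≤-trans shorter too-long)
  where
  w-valid : IsExpr n w
  w-valid = ++⁻ˡ w (++⁻ˡ (w ++ i ∷ []) valid)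
  cancels : Equiv ((w ++ i ∷ []) ++ i ∷ []) w
  cancels p rewrite act-++ (w ++ i ∷ []) (i ∷ []) p | act-++ w (i ∷ []) p =
    swap-involutive i (act w p)
  too-long : length w + 1 + 1 ≤ length w
  too-long = subst (_≤ length w)
               (trans (length-++ (w ++ i ∷ [])) (cong (_+ 1) (length-++ w)))
               (minimal w w-valid cancels)
  shorter : suc (length w) ≤ length w + 1 + 1
  shorter = ≤-trans (≤-reflexive (+-comm 1 (length w))) (m≤m+n (length w + 1) 1)

module Factorisation (n' : ℕ) where

  N : ℕ
  N = suc n'

  record Factored (u : Word) : Set where
    constructor factored
    field
      prefix      : Word
      cut         : ℕ
      prefix-expr : IsExpr n' prefix
      cut-pos     : 1 ≤ cut
      cut-bound   : cut ≤ N
      distance    : DistLe u (prefix ++ sigmaDown N cut) (area N u)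

  widen : ∀ {v} → IsExpr n' v → IsExpr N v
  widen = all-map (λ { (1≤i , si≤n') → 1≤i , m≤n⇒m≤1+n si≤n' })

  factored-expr : ∀ v k → IsExpr n' v → 1 ≤ k → IsExpr N (v ++ sigmaDown N k)
  factored-expr v k v-valid 1≤k = ++⁺ (widen v-valid) (sigmaDown-expr N k 1≤k)

  strand-at-cut : ∀ {u} (F : Factored u) → act u N ≡ Factored.cut F
  strand-at-cut {u} (factored v k v-valid _ k≤N (_ , _ , r)) =
    trans (reaches-equiv r N)
      (trans (act-++ v (sigmaDown N k) N)
        (trans (cong (act (sigmaDown N k)) (act-fixes-above n' v v-valid)) (act-sigmaDown N k k≤N)))

  extend-cut : ∀ {u} i (F : Factored u) → suc i ≡ Factored.cut F → 1 ≤ i → Factored (u ++ i ∷ [])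
  extend-cut {u} i (factored v .(suc i) v-valid _ si≤N dist) refl 1≤i =
    factored v i v-valid 1≤i (≤-trans (n≤1+n i) si≤N)
      (dist-weaken (≤-trans (≤-reflexive (+-identityʳ _)) (area-snoc-≥ N u i))
        (dist-trans (dist-suffix (i ∷ []) dist)
          (subst (λ w → DistLe ((v ++ sigmaDown N (suc i)) ++ i ∷ []) w 0) merged dist-refl)))
    where
    merged : (v ++ sigmaDown N (suc i)) ++ i ∷ [] ≡ v ++ sigmaDown N i
    merged = trans (++-assoc v (sigmaDown N (suc i)) (i ∷ []))
                   (cong (v ++_) (sym (sigmaDown-last N i si≤N)))

  -- Case i = k: impossible, since σ_{N,k} σ_k ends in a square.
  no-cancel : ∀ {u} (F : Factored u) → ¬ Reduced N (u ++ Factored.cut F ∷ [])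
  no-cancel {u} (factored v k v-valid 1≤k _ (_ , _ , r)) red@(valid , _)
    with ++⁻ʳ u valid
  ... | letter-valid@((_ , sk≤N) ∷ []) =
    square-not-reduced N (v ++ sigmaDown N (suc k)) k
      (reduced-reaches red (subst (IsExpr N) as-square extended-valid)
                           (subst (Reaches _ _) as-square (reaches-suffix (k ∷ []) r)))
    where
    extended-valid : IsExpr N ((v ++ sigmaDown N k) ++ k ∷ [])
    extended-valid = ++⁺ (factored-expr v k v-valid 1≤k) letter-valid
    as-square : (v ++ sigmaDown N k) ++ k ∷ [] ≡ ((v ++ sigmaDown N (suc k)) ++ k ∷ []) ++ k ∷ []
    as-square = cong (_++ k ∷ [])
      (trans (cong (v ++_) (sigmaDown-last N k sk≤N)) (sym (++-assoc v (sigmaDown N (suc k)) (k ∷ []))))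

  -- Cases i ≤ k-2 and i ≥ k+1: the letter σ_i crosses σ_{N,k} from the
  -- right, leaving a letter σ_j with j < N-1; the strand at k does not move.
  slide : ∀ {u} i j (F : Factored u) → swap i (Factored.cut F) ≡ Factored.cut F →
          1 ≤ j → suc j ≤ n' →
          DistLe (sigmaDown N (Factored.cut F) ++ i ∷ []) (j ∷ sigmaDown N (Factored.cut F))
                 (length (sigmaDown N (Factored.cut F))) →
          Factored (u ++ i ∷ [])
  slide {u} i j F@(factored v k v-valid 1≤k k≤N dist) fixed 1≤j sj≤n' cross =
    factored (v ++ j ∷ []) k (++⁺ v-valid ((1≤j , sj≤n') ∷ [])) 1≤k k≤N
      (dist-weaken budget (dist-trans (dist-suffix (i ∷ []) dist) (subst₂ (λ a b → DistLe a b _)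
        (sym (++-assoc v σ (i ∷ []))) (sym (++-assoc v (j ∷ []) σ)) (dist-prefix v cross))))
    where
    σ = sigmaDown N k
    budget : area N u + length σ ≤ area N (u ++ i ∷ [])
    budget = ≤-trans (+-monoʳ-≤ (area N u) (sigmaDown-length N k))
                     (≤-reflexive (sym (area-snoc-fixed N u i k (strand-at-cut F) fixed)))

  -- Case i ≤ k-2: σ_i commutes with every letter of σ_{N,k}.
  pass-below : ∀ {u} i (F : Factored u) → suc (suc i) ≤ Factored.cut F → 1 ≤ i →
               Factored (u ++ i ∷ [])
  pass-below i F@(factored _ k _ _ k≤N _) ssi≤k 1≤i =
    slide i i F (swap-above i k ssi≤k) 1≤i (≤-pred (≤-trans ssi≤k k≤N))
      (subst (λ w → DistLe (sigmaDown N k ++ i ∷ []) (i ∷ w) (length (sigmaDown N k)))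
         (++-identityʳ (sigmaDown N k))
        (commute-left i [] (sigmaDown N k)
          (all-map (λ { (k≤x , _) → inj₂ (≤-trans ssi≤k k≤x) }) (sigmaDown-letters N k))))

  pass-above : ∀ {u} i' (F : Factored u) → Factored.cut F ≤ i' → suc (suc i') ≤ N →
               Factored (u ++ suc i' ∷ [])
  pass-above i' F@(factored _ k _ 1≤k _ _) k≤i' ssi'≤N =
    slide (suc i') i' F (swap-below (suc i') k (s≤s k≤i')) (≤-trans 1≤k k≤i') (≤-pred ssi'≤N)
      (subst (λ σ → DistLe (σ ++ suc i' ∷ []) (i' ∷ σ) (length σ))
        (sym (sigmaDown-around N k i' k≤i' ssi'≤N))
        (braid-through i' H L
          (all-map (λ { (ssi'≤x , _) → inj₂ ssi'≤x }) (sigmaDown-letters N (suc (suc i'))))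
          (all-map (λ { (_ , x<i') → inj₁ (s≤s x<i') }) (sigmaDown-letters i' k))))
    where
    H = sigmaDown N (suc (suc i'))
    L = sigmaDown i' k

  factored-snoc : ∀ u i → Reduced N (u ++ i ∷ []) → Factored u → Factored (u ++ i ∷ [])
  factored-snoc u i red@(valid , _) F with ++⁻ʳ u valid | <-cmp i (Factored.cut F)
  ... | (1≤i , _) ∷ [] | tri< i<k _ _ with m≤n⇒m<n∨m≡n i<k
  ...   | inj₂ si≡k = extend-cut i F si≡k 1≤i
  ...   | inj₁ ssi≤k = pass-below i F ssi≤k 1≤i
  factored-snoc u i red F | _ | tri≈ _ refl _ = ⊥-elim (no-cancel F red)
  factored-snoc u zero red F | (() , _) ∷ [] | tri> _ _ _
  factored-snoc u (suc i') red F | (_ , ssi'≤N) ∷ [] | tri> _ _ (s≤s k≤i') =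
    pass-above i' F k≤i' ssi'≤N

  factorise : ∀ {u} → Reverse u → Reduced N u → Factored u
  factorise [] _ = factored [] N [] (s≤s z≤n) ≤-refl
    (subst (λ w → DistLe [] w 0) (sym (sigmaDown-empty N)) dist-refl)
  factorise (u ∶ rest ∶ʳ i) red = factored-snoc u i red (factorise rest (reduced-prefix N u i red))

-- The theorem: the factorisation is reduced because u is, and equivalent
-- to u because braid moves preserve the permutation.
lemma1p3 : (n : ℕ) → 1 ≤ n → (u : Word) → Reduced n u →
    Σ Word (λ v → Σ ℕ (λ k → IsExpr (n ∸ 1) v × 1 ≤ k × k ≤ n ×
      Reduced n (v ++ sigmaDown n k) × Equiv u (v ++ sigmaDown n k) ×
      DistLe u (v ++ sigmaDown n k) (area n u)))
lemma1p3 (suc n') _ u red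
  with Factorisation.factorise n' (reverseView u) red
... | Factorisation.factored v k v-valid 1≤k k≤n dist@(_ , _ , r) =
  v , k , v-valid , 1≤k , k≤n ,
  reduced-reaches red (Factorisation.factored-expr n' v k v-valid 1≤k) r ,
  reaches-equiv r , dist
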